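{- Let $n=p_1p_2\cdots p_k$, where $p_1<p_2<\cdots<p_k$ are primes and $k\ge 6$. Then $\dim(\mathcal{E}_{\mathbb{Z}_n})\le k$.
   Context: An ideal of a commutative ring $R$ with unity is essential if it has nonzero intersection with every nonzero ideal of $R$. The essential ideal graph $\mathcal{E}_{R}$ is the simple graph whose vertices are the nonzero proper ideals of $R$, distinct $\hat I,\hat J$ adjacent iff $\hat I+\hat J$ is essential. For an ordered set $W=\{w_1,\dots,w_t\}$ of vertices of a connected graph $\Gamma$ and a vertex $v$, $r(v\mid W)=(d(v,w_1),\dots,d(v,w_t))$ with $d$ the graph distance; $W$ is resolving if $r(u\mid W)\ne r(v\mid W)$ for all distinct $u,v\notin W$. The metric dimension $\dim(\Gamma)$ is the minimum size of a resolving set. -}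

module Defs where

open import Data.Nat using (ℕ; zero; suc; _+_; _*_; _∸_; _≤_; _<_)
open import Data.Nat.DivMod using (_%_; m%n<n)
open import Data.Fin using (Fin; toℕ; fromℕ<)
open import Data.Fin.Subset using (Subset; _∈_; _∉_)
open import Data.List using (List; length; []; _∷_)
open import Data.Unit using (⊤)
open import Data.List.Relation.Unary.Any using (Any)
open import Data.List.Relation.Unary.All using (All)
open import Data.Product using (Σ; ∃; _×_; _,_; proj₁)
open import Data.Empty using (⊥)
open import Relation.Nullary using (¬_)
open import Relation.Binary.PropositionalEquality using (_≡_; _≢_)

module Zmod (m : ℕ) where

  N : ℕ
  N = suc m

  R : Set
  R = Fin N

  mod : ℕ → R
  mod x = fromℕ< (m%n<n x N)

  0# : R
  0# = mod 0

  _+ᵣ_ : R → R → R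
  a +ᵣ b = mod (toℕ a + toℕ b)

  _*ᵣ_ : R → R → R
  a *ᵣ b = mod (toℕ a * toℕ b)

  -ᵣ_ : R → R
  -ᵣ a = mod (N ∸ toℕ a)

  record IsIdeal (I : Subset N) : Set where
    field
      zero∈ : 0# ∈ I
      +-closed : ∀ a b → a ∈ I → b ∈ I → (a +ᵣ b) ∈ I
      neg-closed : ∀ a → a ∈ I → (-ᵣ a) ∈ I
      *-closed : ∀ r a → a ∈ I → (r *ᵣ a) ∈ I

  NonzeroIdeal : Subset N → Set
  NonzeroIdeal I = ∃ λ x → x ∈ I × x ≢ 0#

  ProperIdeal : Subset N → Set
  ProperIdeal I = ∃ λ x → x ∉ I

  InSum : Subset N → Subset N → R → Set
  InSum I J x = ∃ λ a → ∃ λ b → a ∈ I × b ∈ J × (a +ᵣ b) ≡ x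

  EssentialSum : Subset N → Subset N → Set
  EssentialSum I J =
    (K : Subset N) → IsIdeal K → NonzeroIdeal K →
    ∃ λ x → x ≢ 0# × InSum I J x × x ∈ K

  Vertex : Set
  Vertex = Σ (Subset N) λ I → IsIdeal I × NonzeroIdeal I × ProperIdeal I

  -- vertices are identified by their underlying ideal
  _≠ᵥ_ : Vertex → Vertex → Set
  u ≠ᵥ v = proj₁ u ≢ proj₁ v

  Adj : Vertex → Vertex → Set
  Adj u v = u ≠ᵥ v × EssentialSum (proj₁ u) (proj₁ v)

  data Walk : Vertex → Vertex → ℕ → Set where
    here  : ∀ {u v} → proj₁ u ≡ proj₁ v → Walk u v 0
    step  : ∀ {u w v ℓ} → Adj u w → Walk w v ℓ → Walk u (v) (suc ℓ)

  Dist : Vertex → Vertex → ℕ → Set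
  Dist u v ℓ = Walk u v ℓ × (∀ ℓ' → ℓ' < ℓ → ¬ Walk u v ℓ')

  _∉ᵥ_ : Vertex → List Vertex → Set
  u ∉ᵥ W = All (λ w → u ≠ᵥ w) W

  Resolving : List Vertex → Set
  Resolving W =
    ∀ u v → u ≠ᵥ v → u ∉ᵥ W → v ∉ᵥ W →
    Any (λ w → ∃ λ ℓ₁ → ∃ λ ℓ₂ → Dist u w ℓ₁ × Dist v w ℓ₂ × ℓ₁ ≢ ℓ₂) W

  DistinctList : List Vertex → Set
  DistinctList [] = ⊤
  DistinctList (w ∷ W) = w ∉ᵥ W × DistinctList W

  -- the essential ideal graph is connected (metric dimension is defined
  -- only for connected graphs)
  Connected : Set
  Connected = ∀ u v → ∃ λ ℓ → Walk u v ℓ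

  MetricDimLE : ℕ → Set
  MetricDimLE k = Connected × ∃ λ W → DistinctList W × length W ≤ k × Resolving W

EssIdealGraphDimLE : ℕ → ℕ → Set
EssIdealGraphDimLE zero k = ⊥
EssIdealGraphDimLE (suc m) k = Zmod.MetricDimLE m k

module Submission where

-- The k maximal ideals (p) of ℤ_n form a resolving set. If the ideal I has an element not
-- divisible by p, Bézout gives I + (p) = ℤ_n, so I is adjacent to (p). If I ⊊ (p), then
-- I + (p) = (p) is not essential, yet I reaches (p) through any (q) with I ⊄ (q); so
-- d(I, (p)) = 2. Since n is squarefree, an ideal is determined by the maximal ideals containing
-- it, hence two distinct vertices outside the set are told apart by one of them.

open import Defs
open import Data.Nat using (ℕ; _≤_; _<_)
open import Data.Nat.Primality using (Prime)
open import Data.List using (List; length)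
open import Data.Nat.ListAction using (product)
open import Data.List.Relation.Unary.All using (All)
open import Data.List.Relation.Unary.AllPairs using (AllPairs)

open import Function.Base using (_∘_)
open import Data.Fin.Base using (toℕ)
open import Data.Fin.Properties using (toℕ-fromℕ<; toℕ-injective; toℕ<n)
import Data.Fin.Properties as Fin
open import Data.Fin.Subset using (Subset; _∈_; _∉_; _⊆_)
open import Data.Fin.Subset.Properties using (_∈?_; _⊆?_; ⊆-antisym)
open import Data.Bool.Base using (Bool)
open import Data.Vec.Base using (tabulate)
open import Data.Vec.Properties using (lookup∘tabulate; lookup⇒[]=; []=⇒lookup)
open import Data.List.Base using ([]; _∷_)
open import Data.List.Membership.Propositional using (mapWith∈; find) renaming (_∈_ to _∈ₗ_)
open import Data.List.Relation.Unary.All as All using ([]; _∷_)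
open import Data.List.Relation.Unary.All.Properties using (¬Any⇒All¬)
open import Data.List.Relation.Unary.Any as Any using (Any; here; there; any?)
open import Data.List.Relation.Unary.Any.Properties using (mapWith∈⁺; mapWith∈⁻)
open import Data.List.Relation.Unary.AllPairs as AllPairs using ([]; _∷_)
open import Data.List.Relation.Unary.Unique.Propositional using (Unique)
open import Data.Nat.Base
open import Data.Nat.Properties
open import Data.Nat.Divisibility
open import Data.Nat.DivMod hiding (_mod_)
open import Data.Nat.Coprimality using (Coprime; coprime-Bézout)
open import Data.Nat.GCD using (module Bézout)
open import Data.Nat.ListAction.Properties using (∈⇒∣product)
open import Data.Nat.Primality
  using (euclidsLemma; prime⇒irreducible; prime⇒nonTrivial; productOfPrimes≢0; productOfPrimes≥1)
open import Data.Nat.Tactic.RingSolver using (solve-∀)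
open import Data.Product using (Σ; ∃; _×_; _,_; proj₁)
open import Data.Sum using (_⊎_; inj₁; inj₂; [_,_]′)
open import Relation.Nullary using (Dec; ¬_; yes; no; does; contradiction)
open import Relation.Nullary.Decidable using (decidable-stable; dec-true; ¬?; _×-dec_)
open import Relation.Binary.PropositionalEquality

prime>1 : ∀ {p} → Prime p → 1 < p
prime>1 {p} pp = nonTrivial⇒n>1 p {{prime⇒nonTrivial pp}}

prime∣prime⇒≡ : ∀ {p q} → Prime p → Prime q → p ∣ q → p ≡ q
prime∣prime⇒≡ pp pq p∣q with prime⇒irreducible pq p∣q
... | inj₁ refl = contradiction (prime>1 pp) (<-irrefl refl)
... | inj₂ p≡q = p≡q

prime∤⇒coprime : ∀ {p n} → Prime p → ¬ p ∣ n → Coprime p n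
prime∤⇒coprime pp p∤n (d∣p , d∣n) with prime⇒irreducible pp d∣p
... | inj₁ d≡1 = d≡1
... | inj₂ refl = contradiction d∣n p∤n

prime∣m*p⇒∣m : ∀ {q p m} → Prime q → Prime p → q ≢ p → q ∣ m * p → q ∣ m
prime∣m*p⇒∣m {m = m} pq pp q≢p q∣m*p with euclidsLemma m _ pq q∣m*p
... | inj₁ q∣m = q∣m
... | inj₂ q∣p = contradiction (prime∣prime⇒≡ pq pp q∣p) q≢p

product∣ : ∀ {ps h} → All Prime ps → Unique ps → All (_∣ h) ps → product ps ∣ h
product∣ [] [] [] = 1∣ _
product∣ {p ∷ ps} (pp ∷ primes) (p∉ps ∷ unique) (divides h′ refl ∷ ps∣h) =
  subst (p * product ps ∣_) (*-comm p h′) (*-monoʳ-∣ p (product∣ primes unique ps∣h′))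
  where
  ps∣h′ : All (_∣ h′) ps
  ps∣h′ = All.tabulate λ q∈ps →
    prime∣m*p⇒∣m (All.lookup primes q∈ps) pp (≢-sym (All.lookup p∉ps q∈ps)) (All.lookup ps∣h q∈ps)

∃-prime∤ : ∀ {ps h} → All Prime ps → Unique ps → ¬ product ps ∣ h → ∃ λ p → p ∈ₗ ps × ¬ p ∣ h
∃-prime∤ {ps} {h} primes unique ¬∣ with any? (λ p → ¬? (p ∣? h)) ps
... | yes ∃∤ = find ∃∤
... | no ∄∤ =
  contradiction (product∣ primes unique (All.map (decidable-stable (_ ∣? h)) (¬Any⇒All¬ ps ∄∤))) ¬∣

∃-other : ∀ {xs : List ℕ} → Unique xs → 2 ≤ length xs → ∀ p → ∃ λ q → q ∈ₗ xs × q ≢ p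
∃-other {a ∷ b ∷ _} ((a≢b ∷ _) ∷ _) _ p with p ≟ a
... | yes refl = b , there (here refl) , ≢-sym a≢b
... | no p≢a = a , here refl , ≢-sym p≢a
∃-other {_ ∷ []} _ (s≤s ()) _

∈⇒<product : ∀ {ps p} → All Prime ps → Unique ps → 2 ≤ length ps → p ∈ₗ ps → p < product ps
∈⇒<product {ps} {p} primes unique two p∈ps with ∃-other unique two p
... | q , q∈ps , q≢p = ≤∧≢⇒< (∣⇒≤ {{productOfPrimes≢0 primes}} (∈⇒∣product p∈ps)) p≢product
  where
  p≢product : p ≢ product ps
  p≢product p≡ = q≢p (prime∣prime⇒≡ (All.lookup primes q∈ps) (All.lookup primes p∈ps)
                        (subst (q ∣_) (sym p≡) (∈⇒∣product q∈ps)))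

module _ {ℓ} {P : ℕ → Set ℓ} (P? : ∀ n → Dec (P n)) where

  private
    leastBelow : ∀ n → (∃ λ m → P m × (∀ {k} → k < m → ¬ P k)) ⊎ (∀ {k} → k < n → ¬ P k)
    leastBelow zero = inj₂ λ ()
    leastBelow (suc n) with leastBelow n
    ... | inj₁ least = inj₁ least
    ... | inj₂ none with P? n
    ...   | yes pn = inj₁ (n , pn , none)
    ...   | no ¬pn = inj₂ λ k<1+n → [ none , (λ { refl → ¬pn }) ]′ (m<1+n⇒m<n∨m≡n k<1+n)

  least : ∀ {n} → P n → ∃ λ m → P m × (∀ {k} → k < m → ¬ P k)
  least {n} pn with leastBelow (suc n)
  ... | inj₁ r = r
  ... | inj₂ none = contradiction pn (none (n<1+n n))

⊆⊎⊈ : ∀ {n} (A B : Subset n) → A ⊆ B ⊎ ∃ λ x → x ∈ A × x ∉ B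
⊆⊎⊈ A B with Fin.any? (λ x → x ∈? A ×-dec ¬? (x ∈? B))
... | yes A⊈B = inj₂ A⊈B
... | no ∄ = inj₁ λ {x} x∈A → decidable-stable (x ∈? B) (λ x∉B → ∄ (x , x∈A , x∉B))

length-mapWith∈ : ∀ {a b} {A : Set a} {B : Set b} (xs : List A) (f : ∀ {x} → x ∈ₗ xs → B) →
                  length (mapWith∈ xs f) ≡ length xs
length-mapWith∈ [] f = refl
length-mapWith∈ (x ∷ xs) f = cong suc (length-mapWith∈ xs (f ∘ there))

module IdealsOfZmod (m : ℕ) where
  open Zmod m

  toℕ-mod : ∀ a → toℕ (mod a) ≡ a % N
  toℕ-mod a = toℕ-fromℕ< (m%n<n a N)

  toℕ-mod-< : ∀ {a} → a < N → toℕ (mod a) ≡ a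
  toℕ-mod-< {a} a<N = trans (toℕ-mod a) (m<n⇒m%n≡m a<N)

  mod-toℕ : ∀ x → mod (toℕ x) ≡ x
  mod-toℕ x = toℕ-injective (toℕ-mod-< (toℕ<n x))

  mod-cong : ∀ {a b} → a % N ≡ b % N → mod a ≡ mod b
  mod-cong {a} {b} eq = toℕ-injective (trans (toℕ-mod a) (trans eq (sym (toℕ-mod b))))

  mod-+ : ∀ a b → mod a +ᵣ mod b ≡ mod (a + b)
  mod-+ a b = mod-cong {toℕ (mod a) + toℕ (mod b)} {a + b} (begin
    (toℕ (mod a) + toℕ (mod b)) % N ≡⟨ cong₂ (λ u v → (u + v) % N) (toℕ-mod a) (toℕ-mod b) ⟩
    (a % N + b % N) % N             ≡⟨ %-distribˡ-+ a b N ⟨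
    (a + b) % N                     ∎)
    where open ≡-Reasoning

  mod-* : ∀ a b → mod a *ᵣ mod b ≡ mod (a * b)
  mod-* a b = mod-cong {toℕ (mod a) * toℕ (mod b)} {a * b} (begin
    (toℕ (mod a) * toℕ (mod b)) % N ≡⟨ cong₂ (λ u v → (u * v) % N) (toℕ-mod a) (toℕ-mod b) ⟩
    (a % N * (b % N)) % N           ≡⟨ %-distribˡ-* a b N ⟨
    (a * b) % N                     ∎)
    where open ≡-Reasoning

  mod-+*N : ∀ a k → mod (a + k * N) ≡ mod a
  mod-+*N a k = mod-cong {a + k * N} {a} ([m+kn]%n≡m%n a k N)

  N∣⇒≡0# : ∀ {x} → N ∣ toℕ x → x ≡ 0#
  N∣⇒≡0# {x} N∣x = toℕ-injective (trans (sym (m<n⇒m%n≡m (toℕ<n x))) (n∣m⇒m%n≡0 (toℕ x) N N∣x))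

  ∣-mod : ∀ {d a} → d ∣ N → d ∣ a → d ∣ toℕ (mod a)
  ∣-mod {d} {a} d∣N d∣a = subst (d ∣_) (sym (toℕ-mod a)) (%-presˡ-∣ d∣a d∣N)

  divisibleBy : ℕ → R → Bool
  divisibleBy d x = does (d ∣? toℕ x)

  Multiples : ℕ → Subset N
  Multiples d = tabulate (divisibleBy d)

  ∈-Multiples⁺ : ∀ {d x} → d ∣ toℕ x → x ∈ Multiples d
  ∈-Multiples⁺ {d} {x} d∣x =
    lookup⇒[]= x (Multiples d) (trans (lookup∘tabulate (divisibleBy d) x) (dec-true (d ∣? toℕ x) d∣x))

  ∈-Multiples⁻ : ∀ {d x} → x ∈ Multiples d → d ∣ toℕ x
  ∈-Multiples⁻ {d} {x} x∈ with d ∣? toℕ x | trans (sym (lookup∘tabulate (divisibleBy d) x)) ([]=⇒lookup x∈)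
  ... | yes d∣x | _ = d∣x
  ... | no _ | ()

  Multiples-isIdeal : ∀ {d} → d ∣ N → IsIdeal (Multiples d)
  Multiples-isIdeal {d} d∣N = record
    { zero∈ = ∈-Multiples⁺ (d ∣0)
    ; +-closed = λ a b a∈ b∈ → ∈-Multiples⁺ (∣-mod d∣N (∣m∣n⇒∣m+n (∈-Multiples⁻ a∈) (∈-Multiples⁻ b∈)))
    ; neg-closed = λ a a∈ → ∈-Multiples⁺ (∣-mod d∣N (∣N∸ a (∈-Multiples⁻ a∈)))
    ; *-closed = λ r a a∈ → ∈-Multiples⁺ (∣-mod d∣N (∣n⇒∣m*n (toℕ r) (∈-Multiples⁻ a∈)))
    }
    where
    ∣N∸ : ∀ a → d ∣ toℕ a → d ∣ N ∸ toℕ a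
    ∣N∸ a d∣a = ∣m+n∣m⇒∣n (subst (d ∣_) (sym (m+[n∸m]≡n (<⇒≤ (toℕ<n a)))) d∣N) d∣a

  module Ideal {I : Subset N} (isI : IsIdeal I) where
    open IsIdeal isI

    mod-toℕ-∈ : ∀ {x} → x ∈ I → mod (toℕ x) ∈ I
    mod-toℕ-∈ {x} x∈I = subst (_∈ I) (sym (mod-toℕ x)) x∈I

    +-closedℕ : ∀ a b → mod a ∈ I → mod b ∈ I → mod (a + b) ∈ I
    +-closedℕ a b a∈I b∈I = subst (_∈ I) (mod-+ a b) (+-closed (mod a) (mod b) a∈I b∈I)

    *-closedℕ : ∀ c a → mod a ∈ I → mod (c * a) ∈ I
    *-closedℕ c a a∈I = subst (_∈ I) (mod-* c a) (*-closed (mod c) (mod a) a∈I)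

    cancelˡℕ : ∀ {a b} → mod a ∈ I → mod (a + b) ∈ I → mod b ∈ I
    cancelˡℕ {a} {b} a∈I a+b∈I =
      subst (_∈ I) (trans (cong mod (rearrange a b m)) (mod-+*N b a))
        (+-closedℕ (a + b) (m * a) a+b∈I (*-closedℕ m a a∈I))
      where
      rearrange : ∀ a b m → (a + b) + m * a ≡ b + a * suc m
      rearrange = solve-∀

    N∈ : mod N ∈ I
    N∈ = subst (_∈ I) (mod-cong {0} {N} (sym (n%n≡0 N))) zero∈

    generator : ∀ {x} → x ∈ I → x ≢ 0# → ∃ λ g → mod g ∈ I × (∀ a → mod a ∈ I → g ∣ a)
    generator {x} x∈I x≢0 with least (λ a → (0 <? a) ×-dec (mod a ∈? I)) (0<x , mod-toℕ-∈ x∈I)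
      where
      0<x : 0 < toℕ x
      0<x = n≢0⇒n>0 (λ x≡0 → x≢0 (toℕ-injective x≡0))
    ... | g , (0<g , g∈I) , minimal = g , g∈I , g∣
      where
      instance _ = >-nonZero 0<g
      g∣ : ∀ a → mod a ∈ I → g ∣ a
      g∣ a a∈I = m%n≡0⇒n∣m a g (n≤0⇒n≡0 (≮⇒≥ λ 0<r → minimal (m%n<n a g) (0<r , r∈I)))
        where
        r∈I : mod (a % g) ∈ I
        r∈I = cancelˡℕ {a / g * g} {a % g} (*-closedℕ (a / g) g g∈I)
                (subst (λ z → mod z ∈ I) (trans (m≡m%n+[m/n]*n a g) (+-comm (a % g) _)) a∈I)

  InSum-sym : ∀ {I J y} → InSum I J y → InSum J I y
  InSum-sym (a , b , a∈I , b∈J , refl) = b , a , b∈J , a∈I , cong mod (+-comm (toℕ b) (toℕ a))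

  EssentialSum-sym : ∀ {I J} → EssentialSum I J → EssentialSum J I
  EssentialSum-sym ess K isK K≢0 with ess K isK K≢0
  ... | x , x≢0 , x∈I+J , x∈K = x , x≢0 , InSum-sym x∈I+J , x∈K

  -- The summand taken from J is m b = (N - 1) b, which is - b in ℤ_N.
  InSum-difference : ∀ {I J} → IsIdeal J → ∀ {a b t} → mod a ∈ I → mod b ∈ J → t + b ≡ a →
                     InSum I J (mod t)
  InSum-difference {I} {J} isJ {a} {b} {t} a∈I b∈J t+b≡a =
    mod a , mod (m * b) , a∈I , Ideal.*-closedℕ isJ m b b∈J , (begin
      mod a +ᵣ mod (m * b) ≡⟨ mod-+ a (m * b) ⟩
      mod (a + m * b)      ≡⟨ cong (λ z → mod (z + m * b)) t+b≡a ⟨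
      mod (t + b + m * b)  ≡⟨ cong mod (rearrange t b m) ⟩
      mod (t + b * N)      ≡⟨ mod-+*N t b ⟩
      mod t                ∎)
    where
    open ≡-Reasoning
    rearrange : ∀ t b m → t + b + m * b ≡ t + b * suc m
    rearrange = solve-∀

  ∈-sum-Multiples : ∀ {I p a} → IsIdeal I → Prime p → p ∣ N → mod a ∈ I → ¬ p ∣ a →
                    ∀ y → InSum I (Multiples p) y
  ∈-sum-Multiples {I} {p} {a} isI pp p∣N a∈I p∤a y =
    subst (InSum I (Multiples p)) (mod-toℕ y) (by-Bézout (coprime-Bézout (prime∤⇒coprime pp p∤a)))
    where
    t = toℕ y
    multiple∈ : ∀ c → mod (t * (c * p)) ∈ Multiples p
    multiple∈ c = ∈-Multiples⁺ (∣-mod p∣N (∣n⇒∣m*n t (n∣m*n c)))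
    a-multiple∈ : ∀ c → mod (t * (c * a)) ∈ I
    a-multiple∈ c = Ideal.*-closedℕ isI t (c * a) (Ideal.*-closedℕ isI c a a∈I)
    by-Bézout : Bézout.Identity 1 p a → InSum I (Multiples p) (mod t)
    by-Bézout (Bézout.+- u v eq) =
      InSum-sym (InSum-difference isI {t * (u * p)} {t * (v * a)} {t} (multiple∈ u) (a-multiple∈ v)
                  (trans (sym (*-suc t (v * a))) (cong (t *_) eq)))
    by-Bézout (Bézout.-+ u v eq) =
      InSum-difference (Multiples-isIdeal p∣N) {t * (v * a)} {t * (u * p)} {t}
        (a-multiple∈ v) (multiple∈ u)
        (trans (sym (*-suc t (u * p))) (cong (t *_) eq))

  EssentialSum-Multiples : ∀ {I p a} → IsIdeal I → Prime p → p ∣ N → mod a ∈ I → ¬ p ∣ a →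
                           EssentialSum I (Multiples p)
  EssentialSum-Multiples isI pp p∣N a∈I p∤a K _ (x , x∈K , x≢0) =
    x , x≢0 , ∈-sum-Multiples isI pp p∣N a∈I p∤a x , x∈K

module EssentialIdealGraph (ps : List ℕ) (m : ℕ) (product≡N : product ps ≡ suc m)
       (primes : All Prime ps) (distinct : Unique ps) (two : 2 ≤ length ps) where
  open Zmod m
  open IdealsOfZmod m

  prime : ∀ {p} → p ∈ₗ ps → Prime p
  prime = All.lookup primes

  ∣N : ∀ {p} → p ∈ₗ ps → p ∣ N
  ∣N p∈ps = subst (_ ∣_) product≡N (∈⇒∣product p∈ps)

  all∣⇒≡0# : ∀ {x} → All (_∣ toℕ x) ps → x ≡ 0#
  all∣⇒≡0# ps∣x = N∣⇒≡0# (subst (_∣ _) product≡N (product∣ primes distinct ps∣x))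

  ∃-prime∤-≢0# : ∀ {x} → x ≢ 0# → ∃ λ p → p ∈ₗ ps × ¬ p ∣ toℕ x
  ∃-prime∤-≢0# x≢0 = ∃-prime∤ primes distinct (λ N∣x → x≢0 (N∣⇒≡0# (subst (_∣ _) product≡N N∣x)))

  toℕ-mod-prime : ∀ {p} → p ∈ₗ ps → toℕ (mod p) ≡ p
  toℕ-mod-prime p∈ps = toℕ-mod-< (subst (_ <_) product≡N (∈⇒<product primes distinct two p∈ps))

  mod-prime∈Multiples : ∀ {p} → p ∈ₗ ps → mod p ∈ Multiples p
  mod-prime∈Multiples {p} p∈ps = ∈-Multiples⁺ (subst (p ∣_) (sym (toℕ-mod-prime p∈ps)) ∣-refl)

  maximal : ∀ {p} → p ∈ₗ ps → Vertex
  maximal {p} p∈ps =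
    Multiples p , Multiples-isIdeal (∣N p∈ps) , (mod p , mod-prime∈Multiples p∈ps , p≢0#) , (mod 1 , 1∉)
    where
    p≢0# : mod p ≢ 0#
    p≢0# p≡0 = <⇒≢ (<-trans z<s (prime>1 (prime p∈ps))) (trans (cong toℕ (sym p≡0)) (toℕ-mod-prime p∈ps))
    1∉ : mod 1 ∉ Multiples p
    1∉ 1∈ = <⇒≢ (prime>1 (prime p∈ps)) (sym (∣1⇒≡1 (subst (p ∣_) (toℕ-mod-< 1<N) (∈-Multiples⁻ 1∈))))
      where
      1<N : 1 < N
      1<N = subst (1 <_) product≡N (<-trans (prime>1 (prime p∈ps)) (∈⇒<product primes distinct two p∈ps))

  adjacent-maximal : ∀ u {p} (p∈ps : p ∈ₗ ps) {x} → x ∈ proj₁ u → ¬ p ∣ toℕ x → Adj u (maximal p∈ps)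
  adjacent-maximal (I , isI , _) p∈ps {x} x∈I p∤x =
    (λ I≡M → p∤x (∈-Multiples⁻ (subst (x ∈_) I≡M x∈I))) ,
    EssentialSum-Multiples isI (prime p∈ps) (∣N p∈ps) (Ideal.mod-toℕ-∈ isI x∈I) p∤x

  maximal-adjacent : ∀ {p q} (p∈ps : p ∈ₗ ps) (q∈ps : q ∈ₗ ps) → p ≢ q →
                     Adj (maximal p∈ps) (maximal q∈ps)
  maximal-adjacent {p} {q} p∈ps q∈ps p≢q =
    adjacent-maximal (maximal p∈ps) q∈ps (mod-prime∈Multiples p∈ps)
    λ q∣p → p≢q (sym (prime∣prime⇒≡ (prime q∈ps) (prime p∈ps) (subst (q ∣_) (toℕ-mod-prime p∈ps) q∣p)))

  -- I + (p) lies in (p), which meets the nonzero ideal (N / p) only in 0.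
  ¬EssentialSum-⊆ : ∀ {I p} → p ∈ₗ ps → I ⊆ Multiples p → ¬ EssentialSum I (Multiples p)
  ¬EssentialSum-⊆ {I} {p} p∈ps I⊆M ess with ∣N p∈ps
  ... | divides zero ()
  ... | divides Q@(suc _) N≡Q*p with ess (Multiples Q) (Multiples-isIdeal Q∣N) (mod Q , Q∈ , Q≢0#)
    where
    Q∣N : Q ∣ N
    Q∣N = divides p (trans N≡Q*p (*-comm Q p))
    toℕ-mod-Q : toℕ (mod Q) ≡ Q
    toℕ-mod-Q = toℕ-mod-< (subst (Q <_) (sym N≡Q*p) (m<m*n Q p (prime>1 (prime p∈ps))))
    Q∈ : mod Q ∈ Multiples Q
    Q∈ = ∈-Multiples⁺ (subst (Q ∣_) (sym toℕ-mod-Q) ∣-refl)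
    Q≢0# : mod Q ≢ 0#
    Q≢0# Q≡0 = 1+n≢0 (trans (sym toℕ-mod-Q) (cong toℕ Q≡0))
  ... | x , x≢0 , (a , b , a∈I , b∈M , refl) , x∈K = x≢0 (all∣⇒≡0# (All.tabulate ∣x))
    where
    p∣x : p ∣ toℕ x
    p∣x = ∣-mod (∣N p∈ps) (∣m∣n⇒∣m+n (∈-Multiples⁻ (I⊆M a∈I)) (∈-Multiples⁻ b∈M))
    ∣x : ∀ {q} → q ∈ₗ ps → q ∣ toℕ x
    ∣x {q} q∈ps with q ≟ p
    ... | yes refl = p∣x
    ... | no q≢p = ∣-trans (prime∣m*p⇒∣m (prime q∈ps) (prime p∈ps) q≢p (subst (q ∣_) N≡Q*p (∣N q∈ps)))
                           (∈-Multiples⁻ {Q} x∈K)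

  edge : ∀ {u v} → Adj u v → Walk u v 1
  edge {v = v} adj = step {w = v} adj (here refl)

  dist-maximal-⊈ : ∀ u {p} (p∈ps : p ∈ₗ ps) {x} → x ∈ proj₁ u → ¬ p ∣ toℕ x → Dist u (maximal p∈ps) 1
  dist-maximal-⊈ u p∈ps x∈I p∤x = edge adj , shorter
    where
    adj : Adj u (maximal p∈ps)
    adj = adjacent-maximal u p∈ps x∈I p∤x
    shorter : ∀ ℓ → ℓ < 1 → ¬ Walk u (maximal p∈ps) ℓ
    shorter zero _ (here I≡M) = proj₁ adj I≡M
    shorter (suc _) (s≤s ()) _

  dist-maximal-⊆ : ∀ u {p} (p∈ps : p ∈ₗ ps) → proj₁ u ⊆ Multiples p → proj₁ u ≢ Multiples p →
                   Dist u (maximal p∈ps) 2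
  dist-maximal-⊆ u@(I , isI , (x , x∈I , x≢0) , _) {p} p∈ps I⊆M I≢M with ∃-prime∤-≢0# x≢0
  ... | q , q∈ps , q∤x =
    step {w = maximal q∈ps} (adjacent-maximal u q∈ps x∈I q∤x) (edge (maximal-adjacent q∈ps p∈ps q≢p)) , shorter
    where
    q≢p : q ≢ p
    q≢p refl = q∤x (∈-Multiples⁻ (I⊆M x∈I))
    shorter : ∀ ℓ → ℓ < 2 → ¬ Walk u (maximal p∈ps) ℓ
    shorter zero _ (here I≡M) = I≢M I≡M
    shorter (suc zero) _ (step (_ , ess) (here J≡M)) =
      ¬EssentialSum-⊆ p∈ps I⊆M (subst (EssentialSum I) J≡M ess)
    shorter (suc (suc _)) (s≤s (s≤s ())) _

  edge⁻ : ∀ {u v} → Adj u v → Walk v u 1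
  edge⁻ (u≢v , ess) = edge (≢-sym u≢v , EssentialSum-sym ess)

  walk-from : ∀ {u u′ v ℓ} → proj₁ u ≡ proj₁ u′ → Walk u′ v ℓ → Walk u v ℓ
  walk-from u≡u′ (here u′≡v) = here (trans u≡u′ u′≡v)
  walk-from {u} u≡u′ (step {w = w} adj rest) =
    step {u = u} (subst (λ I → I ≢ proj₁ w × EssentialSum I (proj₁ w)) (sym u≡u′) adj) rest

  _++ʷ_ : ∀ {u w v a b} → Walk u w a → Walk w v b → Walk u v (a + b)
  here u≡w ++ʷ rest = walk-from u≡w rest
  step adj walk ++ʷ rest = step adj (walk ++ʷ rest)

  adjacent-some-maximal : ∀ u → ∃ λ p → Σ (p ∈ₗ ps) λ p∈ps → Adj u (maximal p∈ps)
  adjacent-some-maximal u@(_ , _ , (x , x∈I , x≢0) , _) with ∃-prime∤-≢0# x≢0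
  ... | p , p∈ps , p∤x = p , p∈ps , adjacent-maximal u p∈ps x∈I p∤x

  walk-maximal : ∀ {p q} (p∈ps : p ∈ₗ ps) (q∈ps : q ∈ₗ ps) → ∃ λ ℓ → Walk (maximal p∈ps) (maximal q∈ps) ℓ
  walk-maximal {p} {q} p∈ps q∈ps with p ≟ q
  ... | yes refl = 0 , here refl
  ... | no p≢q = 1 , edge (maximal-adjacent p∈ps q∈ps p≢q)

  connected : Connected
  connected u v with adjacent-some-maximal u | adjacent-some-maximal v
  ... | _ , p∈ps , u~p | _ , q∈ps , v~q with walk-maximal p∈ps q∈ps
  ...   | _ , p⇝q = _ , step u~p (p⇝q ++ʷ edge⁻ v~q)

  -- With N = c g every prime of N divides c x, so c g ∣ c x.
  ∈-principal : ∀ {J g} → IsIdeal J → mod g ∈ J → (∀ a → mod a ∈ J → g ∣ a) → ∀ {x} →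
                (∀ {p} → p ∈ₗ ps → J ⊆ Multiples p → p ∣ toℕ x) → x ∈ J
  ∈-principal {J} {g} isJ g∈J g∣ {x} hyp with g∣ N (Ideal.N∈ isJ)
  ... | divides zero ()
  ... | divides c@(suc _) N≡c*g with *-cancelˡ-∣ c (subst (_∣ c * toℕ x) N≡c*g N∣c*x)
    where
    ∣c*x : ∀ {q} → q ∈ₗ ps → q ∣ c * toℕ x
    ∣c*x {q} q∈ps with euclidsLemma c g (prime q∈ps) (subst (q ∣_) N≡c*g (∣N q∈ps))
    ... | inj₁ q∣c = ∣m⇒∣m*n (toℕ x) q∣c
    ... | inj₂ q∣g = ∣n⇒∣m*n c (hyp q∈ps λ {z} z∈J →
                       ∈-Multiples⁺ (∣-trans q∣g (g∣ (toℕ z) (Ideal.mod-toℕ-∈ isJ z∈J))))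
    N∣c*x : N ∣ c * toℕ x
    N∣c*x = subst (_∣ _) product≡N (product∣ primes distinct (All.tabulate ∣c*x))
  ...   | divides k x≡k*g =
    subst (_∈ J) (mod-toℕ x) (subst (λ z → mod z ∈ J) (sym x≡k*g) (Ideal.*-closedℕ isJ k g g∈J))

  ∈-of-maximals : ∀ {J} → IsIdeal J → NonzeroIdeal J → ∀ {x} →
                  (∀ {p} → p ∈ₗ ps → J ⊆ Multiples p → p ∣ toℕ x) → x ∈ J
  ∈-of-maximals isJ (y , y∈J , y≢0) =
    let _ , g∈J , g∣ = Ideal.generator isJ y∈J y≢0 in ∈-principal isJ g∈J g∣

  separating-maximal : ∀ (v : Vertex) {x} → x ∉ proj₁ v →
                       ∃ λ p → p ∈ₗ ps × proj₁ v ⊆ Multiples p × ¬ p ∣ toℕ x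
  separating-maximal (J , isJ , J≢0 , _) {x} x∉J
    with any? (λ p → (J ⊆? Multiples p) ×-dec ¬? (p ∣? toℕ x)) ps
  ... | yes found = find found
  ... | no none = contradiction (∈-of-maximals isJ J≢0 ∣x) x∉J
    where
    ∣x : ∀ {p} → p ∈ₗ ps → J ⊆ Multiples p → p ∣ toℕ x
    ∣x p∈ps J⊆M = decidable-stable (_ ∣? toℕ x) λ p∤x → All.lookup (¬Any⇒All¬ ps none) p∈ps (J⊆M , p∤x)

  W : List Vertex
  W = mapWith∈ ps maximal

  ∉W⇒≢maximal : ∀ u {p} → u ∉ᵥ W → (p∈ps : p ∈ₗ ps) → proj₁ u ≢ Multiples p
  ∉W⇒≢maximal u u∉W p∈ps = All.lookup u∉W (mapWith∈⁺ maximal (_ , p∈ps , refl))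

  DistinctList-mapWith∈ : ∀ {xs : List ℕ} (f : ∀ {x} → x ∈ₗ xs → Vertex) → Unique xs →
                          (∀ {x y} (x∈xs : x ∈ₗ xs) (y∈xs : y ∈ₗ xs) → x ≢ y → f x∈xs ≠ᵥ f y∈xs) →
                          DistinctList (mapWith∈ xs f)
  DistinctList-mapWith∈ {[]} f [] f-inj = _
  DistinctList-mapWith∈ {x ∷ xs} f (x∉xs ∷ unique) f-inj =
    All.tabulate head≢ , DistinctList-mapWith∈ (f ∘ there) unique (λ a b → f-inj (there a) (there b))
    where
    head≢ : ∀ {w} → w ∈ₗ mapWith∈ xs (f ∘ there) → f (here refl) ≠ᵥ w
    head≢ w∈ with mapWith∈⁻ xs (f ∘ there) w∈
    ... | y , y∈xs , refl = f-inj (here refl) (there y∈xs) (All.lookup x∉xs y∈xs)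

  W-distinct : DistinctList W
  W-distinct =
    DistinctList-mapWith∈ maximal distinct λ p∈ps q∈ps p≢q → proj₁ (maximal-adjacent p∈ps q∈ps p≢q)

  Resolves : Vertex → Vertex → Vertex → Set
  Resolves u v w = ∃ λ ℓ₁ → ∃ λ ℓ₂ → Dist u w ℓ₁ × Dist v w ℓ₂ × ℓ₁ ≢ ℓ₂

  Resolves-sym : ∀ {u v w} → Resolves u v w → Resolves v u w
  Resolves-sym (ℓ₁ , ℓ₂ , d₁ , d₂ , ℓ₁≢ℓ₂) = ℓ₂ , ℓ₁ , d₂ , d₁ , ≢-sym ℓ₁≢ℓ₂

  resolves-⊈ : ∀ u v {x} → x ∈ proj₁ u → x ∉ proj₁ v → v ∉ᵥ W → Any (Resolves u v) W
  resolves-⊈ u v x∈I x∉J v∉W with separating-maximal v x∉J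
  ... | p , p∈ps , J⊆M , p∤x = mapWith∈⁺ maximal (p , p∈ps , 1 , 2 ,
        dist-maximal-⊈ u p∈ps x∈I p∤x , dist-maximal-⊆ v p∈ps J⊆M (∉W⇒≢maximal v v∉W p∈ps) , λ ())

  resolving : Resolving W
  resolving u v u≢v u∉W v∉W with ⊆⊎⊈ (proj₁ u) (proj₁ v)
  ... | inj₂ (x , x∈I , x∉J) = resolves-⊈ u v x∈I x∉J v∉W
  ... | inj₁ I⊆J with ⊆⊎⊈ (proj₁ v) (proj₁ u)
  ...   | inj₁ J⊆I = contradiction (⊆-antisym I⊆J J⊆I) u≢v
  ...   | inj₂ (x , x∈J , x∉I) = Any.map Resolves-sym (resolves-⊈ v u x∈J x∉I u∉W)

  metricDim≤ : MetricDimLE (length ps)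
  metricDim≤ = connected , W , W-distinct , ≤-reflexive (length-mapWith∈ ps maximal) , resolving

mainTheorem6 : (ps : List ℕ) → All Prime ps → AllPairs _<_ ps → 6 ≤ length ps →
    EssIdealGraphDimLE (product ps) (length ps)
mainTheorem6 ps primes increasing 6≤k with product ps in product≡
... | zero = contradiction (subst (1 ≤_) product≡ (productOfPrimes≥1 primes)) λ ()
... | suc m = EssentialIdealGraph.metricDim≤ ps m product≡ primes (AllPairs.map <⇒≢ increasing) 2≤k
  where
  2≤k : 2 ≤ length ps
  2≤k = ≤-trans (s≤s (s≤s z≤n)) 6≤k
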